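{- Let $\alpha=a_n\omega^n+\cdots+a_1\omega$ and $\beta=b_m\omega^m+\cdots+b_1\omega$ be limit ordinals written in Cantor normal form, of finite degrees $n=\deg(\alpha)\ge 2$ and $m=\deg(\beta)\ge 2$ (with $a_n,b_m\neq 0$), and let $p,q$ be natural numbers with $p,q>0$. Then $\mathrm{D}(p\alpha+q\beta)=p\,\mathrm{D}(\alpha)+q\,\mathrm{D}(\beta)$. Moreover: (1) if $n<m$, then $\mathrm{D}(p\alpha+q\beta)\cong qb_m\omega^{m-1}+b_{m-1}\omega^{m-2}+\cdots+b_2\omega+b_1$; (2) if $n=m$, then $\mathrm{D}(p\alpha+q\beta)\cong (pa_n+qb_n)\omega^{n-1}+b_{n-1}\omega^{n-2}+\cdots+b_2\omega+b_1$; (3) if $n>m$, then $\mathrm{D}(p\alpha+q\beta)\cong pa_n\omega^{n-1}+a_{n-1}\omega^{n-2}+\cdots+a_{m+1}\omega^m+(a_m+qb_m)\omega^{m-1}+b_{m-1}\omega^{m-2}+\cdots+b_1$.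
   Context: Products of linear orders are lexicographic: $LM$ is $L\times M$ ordered by $(l,m)<(l',m')$ iff $l<l'$ or ($l=l'$ and $m<m'$), i.e. each point of $L$ is replaced by a copy of $M$. Hence for a natural number $p$ and ordinal $\alpha$, $p\alpha$ is $\alpha+\cdots+\alpha$ ($p$ copies), $\omega^n=\omega\cdots\omega$, and $a\,\omega^n$ is $\omega^n+\cdots+\omega^n$ ($a$ copies). Every ordinal of finite degree has a unique Cantor normal form $a_n\omega^n+\cdots+a_1\omega+a_0$ with $a_i\in\omega$, $a_n\ne0$; $n$ is its degree. For a linear order $L$, $x\sim_F y$ iff only finitely many points lie between $x$ and $y$; $L/\!\sim_F$ is the ordered set of equivalence classes (intervals). For an ordinal $\alpha$, $\mathrm{D}(\alpha)$ denotes the ordinal isomorphic to $\alpha/\!\sim_F$ (the finite condensation derivative). -}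

module Defs where

open import Data.Nat as ℕ using (ℕ; zero; suc; _+_; _*_; _∸_; _<ᵇ_; _≡ᵇ_)
open import Data.Fin as F using (Fin)
open import Data.Bool using (if_then_else_)
open import Data.Unit using (⊤)
open import Data.Empty using (⊥)
open import Data.Product using (Σ; _×_; ∃)
open import Data.Sum using (_⊎_; inj₁; inj₂)
open import Data.List using (List)
open import Data.List.Membership.Propositional using (_∈_)
open import Relation.Binary.PropositionalEquality using (_≡_)
open import Relation.Nullary using (¬_)
open import Function.Bundles using (_⇔_)

record LO : Set₁ where
  field
    Carrier : Set
    _≺_     : Carrier → Carrier → Set
open LO public

-- Lexicographic product L M : each point of L replaced by a copy of M.
_⊗_ : LO → LO → LO
L ⊗ M = record
  { Carrier = Carrier L × Carrier M
  ; _≺_ = λ { (l , m) (l′ , m′) → _≺_ L l l′ ⊎ (l ≡ l′ × _≺_ M m m′) } }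
  where open Data.Product using (_,_)

_⊕_ : LO → LO → LO
L ⊕ M = record { Carrier = Carrier L ⊎ Carrier M ; _≺_ = ord }
  where
  ord : Carrier L ⊎ Carrier M → Carrier L ⊎ Carrier M → Set
  ord (inj₁ x) (inj₁ y) = _≺_ L x y
  ord (inj₁ x) (inj₂ y) = ⊤
  ord (inj₂ x) (inj₁ y) = ⊥
  ord (inj₂ x) (inj₂ y) = _≺_ M x y

infixl 6 _⊕_
infixl 7 _⊗_

finLO : ℕ → LO
finLO p = record { Carrier = Fin p ; _≺_ = F._<_ }

ωLO : LO
ωLO = record { Carrier = ℕ ; _≺_ = ℕ._<_ }

oneLO : LO
oneLO = record { Carrier = ⊤ ; _≺_ = λ _ _ → ⊥ }

ωpow : ℕ → LO
ωpow zero    = oneLO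
ωpow (suc k) = ωLO ⊗ ωpow k

_·_ : ℕ → LO → LO
p · L = finLO p ⊗ L

infixl 8 _·_

term : ℕ → ℕ → LO
term c k = c · ωpow k

cnf : (ℕ → ℕ) → ℕ → LO
cnf a zero    = term (a zero) zero
cnf a (suc k) = term (a (suc k)) (suc k) ⊕ cnf a k

Between : (L : LO) → Carrier L → Carrier L → Carrier L → Set
Between L x y z = (_≺_ L x z × _≺_ L z y) ⊎ (_≺_ L y z × _≺_ L z x)

SimF : (L : LO) → Carrier L → Carrier L → Set
SimF L x y = Σ (List (Carrier L)) λ xs → ∀ z → Between L x y z → z ∈ xs

-- Condenses L M : M is isomorphic (as an ordered set) to L/∼F, i.e.
-- there is a surjection f : L → M whose kernel is ∼F and such that
-- f x < f y in M iff x < y and x ≁F y (the induced order on classes).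
Condenses : LO → LO → Set
Condenses L M =
  Σ (Carrier L → Carrier M) λ f →
    (∀ u → ∃ λ x → f x ≡ u)
    × (∀ x y → (f x ≡ f y) ⇔ SimF L x y)
    × (∀ x y → _≺_ M (f x) (f y) ⇔ (_≺_ L x y × ¬ SimF L x y))

mergeCoeff : (ℕ → ℕ) → (ℕ → ℕ) → ℕ → ℕ → ℕ → ℕ
mergeCoeff a b m q k =
  if k <ᵇ (m ∸ 1) then b (suc k)
  else if k ≡ᵇ (m ∸ 1) then a m + q * b m
  else a (suc k)

-- A limit ordinal α = a_n ω^n + ⋯ + a_1 ω is, as a linear order, α′ × ω ordered
-- lexicographically (each point of α′ = a_n ω^(n-1) + ⋯ + a_1 replaced by a copy of ω), and
-- for any strict total order M the ∼F-classes of M × ω are exactly the fibres {u} × ω; hence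
-- D(α) = α′.  Since p (M × ω) + q (N × ω) ≅ (p M + q N) × ω, the same argument gives
-- D(pα + qβ) = pα′ + qβ′ = p D(α) + q D(β), and the three explicit forms come from computing
-- pα′ + qβ′ in Cantor normal form, where the leading term of the right summand absorbs every
-- smaller term of the left one.

module Submission where

open import Defs
open import Data.Empty using (⊥; ⊥-elim)
import Data.Fin as Fin
import Data.Fin.Properties as Finₚ
open import Data.List using (List; map; upTo)
open import Data.List.Extrema.Nat using (max; ⊥≤max; xs≤max)
open import Data.List.Membership.Propositional using (_∈_; _∉_)
open import Data.List.Membership.Propositional.Properties using (∈-map⁺; ∈-upTo⁺)
import Data.List.Relation.Unary.All as All
open import Data.Nat
  using (ℕ; zero; suc; _+_; _*_; _∸_; _≤_; _<_; _>_; s≤s; z≤n; z<s; _⊔_; _≤′_; ≤′-refl; ≤′-step; _<ᵇ_; _≡ᵇ_)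
open import Data.Nat.Properties
  using (<-cmp; <-irrefl; <-irrelevant; +-identityʳ; *-identityʳ; +-suc; m≤n⇒∃[o]m+o≡n; m≤m+n; m<m+n; +-monoʳ-<
        ; ≤⇒≤′; ≤′⇒≤; ≤-pred; ≤-refl; m≤m⊔n; m≤n⊔m; <-≤-trans; m<n⇒m<1+n; n≮0; <ᵇ-reflects-<; ≡ᵇ⇒≡; ≡⇒≡ᵇ
        ; m*n≡0⇒m≡0∨n≡0; <-asym)
open import Data.Product using (Σ; _×_; _,_; proj₁; proj₂; ∃)
import Data.Product as Product
open import Data.Sum using (_⊎_; inj₁; inj₂)
import Data.Sum as Sum
open import Data.Sum.Properties using (inj₁-injective; inj₂-injective)
open import Data.Bool using (true; false)
open import Data.Unit using (tt)
open import Data.Vec using (Vec; []; _∷_; replicate; tail; _∷ʳ_; init; last; initLast)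
open import Data.Vec.Properties using (∷-injective; init-∷ʳ; last-∷ʳ)
open import Function using (_∘_; id)
open import Function.Bundles using (_⇔_; mk⇔; module Equivalence)
open import Function.Properties.Equivalence using () renaming (sym to ⇔-sym; trans to ⇔-trans)
open import Relation.Binary.Consequences using (tri⇒irr; tri⇒asym; tri⇒dec<)
open import Relation.Binary.Definitions using (Trichotomous; tri<; tri≈; tri>)
open import Relation.Binary.PropositionalEquality using (_≡_; _≢_; refl; sym; trans; cong; cong₂; subst; subst₂)
open import Relation.Nullary using (¬_; yes; no; contradiction)
open import Relation.Nullary.Reflects using (ofʸ; ofⁿ)

module ⇔ = Equivalence

variable
  L L′ M M′ N : LO

-- Order isomorphisms

Lt : (L : LO) → Carrier L → Carrier L → Set
Lt = _≺_

syntax Lt L x y = x ≺⟨ L ⟩ y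

record _≅_ (L M : LO) : Set where
  field
    to         : Carrier L → Carrier M
    from       : Carrier M → Carrier L
    from∘to    : ∀ x → from (to x) ≡ x
    to∘from    : ∀ y → to (from y) ≡ y
    to-mono    : ∀ {x y} → x ≺⟨ L ⟩ y → to x ≺⟨ M ⟩ to y
    to-reflect : ∀ {x y} → to x ≺⟨ M ⟩ to y → x ≺⟨ L ⟩ y

open _≅_ public

infix 4 _≅_

≅-refl : L ≅ L
≅-refl .to = id
≅-refl .from = id
≅-refl .from∘to _ = refl
≅-refl .to∘from _ = refl
≅-refl .to-mono = id
≅-refl .to-reflect = id

≅-sym : L ≅ M → M ≅ L
≅-sym e .to = from e
≅-sym e .from = to e
≅-sym e .from∘to = to∘from e
≅-sym e .to∘from = from∘to e
≅-sym {M = M} e .to-mono {x} {y} x≺y =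
  to-reflect e (subst₂ (Lt M) (sym (to∘from e x)) (sym (to∘from e y)) x≺y)
≅-sym {M = M} e .to-reflect {x} {y} fx≺fy =
  subst₂ (Lt M) (to∘from e x) (to∘from e y) (to-mono e fx≺fy)

≅-trans : L ≅ M → M ≅ N → L ≅ N
≅-trans e f .to = to f ∘ to e
≅-trans e f .from = from e ∘ from f
≅-trans e f .from∘to x = trans (cong (from e) (from∘to f (to e x))) (from∘to e x)
≅-trans e f .to∘from z = trans (cong (to f) (to∘from e (from f z))) (to∘from f z)
≅-trans e f .to-mono = to-mono f ∘ to-mono e
≅-trans e f .to-reflect = to-reflect e ∘ to-reflect f

to-injective : (e : L ≅ M) {x y : Carrier L} → to e x ≡ to e y → x ≡ y
to-injective e {x} {y} eq = trans (sym (from∘to e x)) (trans (cong (from e) eq) (from∘to e y))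

empty-≅ : ¬ Carrier L → ¬ Carrier M → L ≅ M
empty-≅ ¬x ¬y .to x = ⊥-elim (¬x x)
empty-≅ ¬x ¬y .from y = ⊥-elim (¬y y)
empty-≅ ¬x ¬y .from∘to x = ⊥-elim (¬x x)
empty-≅ ¬x ¬y .to∘from y = ⊥-elim (¬y y)
empty-≅ ¬x ¬y .to-mono {x} = ⊥-elim (¬x x)
empty-≅ ¬x ¬y .to-reflect {x} = ⊥-elim (¬x x)

⊕-cong : L ≅ L′ → M ≅ M′ → L ⊕ M ≅ L′ ⊕ M′
⊕-cong e f .to = Sum.map (to e) (to f)
⊕-cong e f .from = Sum.map (from e) (from f)
⊕-cong e f .from∘to (inj₁ x) = cong inj₁ (from∘to e x)
⊕-cong e f .from∘to (inj₂ y) = cong inj₂ (from∘to f y)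
⊕-cong e f .to∘from (inj₁ x) = cong inj₁ (to∘from e x)
⊕-cong e f .to∘from (inj₂ y) = cong inj₂ (to∘from f y)
⊕-cong e f .to-mono {inj₁ _} {inj₁ _} x≺y = to-mono e x≺y
⊕-cong e f .to-mono {inj₁ _} {inj₂ _} _ = tt
⊕-cong e f .to-mono {inj₂ _} {inj₂ _} x≺y = to-mono f x≺y
⊕-cong e f .to-reflect {inj₁ _} {inj₁ _} x≺y = to-reflect e x≺y
⊕-cong e f .to-reflect {inj₁ _} {inj₂ _} _ = tt
⊕-cong e f .to-reflect {inj₂ _} {inj₂ _} x≺y = to-reflect f x≺y

⊗-congˡ : M ≅ M′ → L ⊗ M ≅ L ⊗ M′
⊗-congˡ e .to = Product.map₂ (to e)
⊗-congˡ e .from = Product.map₂ (from e)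
⊗-congˡ e .from∘to (l , m) = cong (l ,_) (from∘to e m)
⊗-congˡ e .to∘from (l , m) = cong (l ,_) (to∘from e m)
⊗-congˡ e .to-mono = Sum.map₂ (Product.map₂ (to-mono e))
⊗-congˡ e .to-reflect = Sum.map₂ (Product.map₂ (to-reflect e))

⊗-assoc : (L ⊗ M) ⊗ N ≅ L ⊗ (M ⊗ N)
⊗-assoc .to ((l , m) , n) = l , (m , n)
⊗-assoc .from (l , (m , n)) = (l , m) , n
⊗-assoc .from∘to _ = refl
⊗-assoc .to∘from _ = refl
⊗-assoc .to-mono (inj₁ (inj₁ l≺l′)) = inj₁ l≺l′
⊗-assoc .to-mono (inj₁ (inj₂ (refl , m≺m′))) = inj₂ (refl , inj₁ m≺m′)
⊗-assoc .to-mono (inj₂ (refl , n≺n′)) = inj₂ (refl , inj₂ (refl , n≺n′))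
⊗-assoc .to-reflect (inj₁ l≺l′) = inj₁ (inj₁ l≺l′)
⊗-assoc .to-reflect (inj₂ (refl , inj₁ m≺m′)) = inj₁ (inj₂ (refl , m≺m′))
⊗-assoc .to-reflect (inj₂ (refl , inj₂ (refl , n≺n′))) = inj₂ (refl , n≺n′)

⊗-distribʳ-⊕ : (L ⊕ M) ⊗ N ≅ L ⊗ N ⊕ M ⊗ N
⊗-distribʳ-⊕ .to (inj₁ l , n) = inj₁ (l , n)
⊗-distribʳ-⊕ .to (inj₂ m , n) = inj₂ (m , n)
⊗-distribʳ-⊕ .from (inj₁ (l , n)) = inj₁ l , n
⊗-distribʳ-⊕ .from (inj₂ (m , n)) = inj₂ m , n
⊗-distribʳ-⊕ .from∘to (inj₁ _ , _) = refl
⊗-distribʳ-⊕ .from∘to (inj₂ _ , _) = refl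
⊗-distribʳ-⊕ .to∘from (inj₁ _) = refl
⊗-distribʳ-⊕ .to∘from (inj₂ _) = refl
⊗-distribʳ-⊕ .to-mono {inj₁ _ , _} {inj₁ _ , _} (inj₁ l≺l′) = inj₁ l≺l′
⊗-distribʳ-⊕ .to-mono {inj₁ _ , _} {inj₁ _ , _} (inj₂ (refl , n≺n′)) = inj₂ (refl , n≺n′)
⊗-distribʳ-⊕ .to-mono {inj₁ _ , _} {inj₂ _ , _} _ = tt
⊗-distribʳ-⊕ .to-mono {inj₂ _ , _} {inj₁ _ , _} (inj₂ (() , _))
⊗-distribʳ-⊕ .to-mono {inj₂ _ , _} {inj₂ _ , _} (inj₁ m≺m′) = inj₁ m≺m′
⊗-distribʳ-⊕ .to-mono {inj₂ _ , _} {inj₂ _ , _} (inj₂ (refl , n≺n′)) = inj₂ (refl , n≺n′)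
⊗-distribʳ-⊕ .to-reflect {inj₁ _ , _} {inj₁ _ , _} (inj₁ l≺l′) = inj₁ l≺l′
⊗-distribʳ-⊕ .to-reflect {inj₁ _ , _} {inj₁ _ , _} (inj₂ (refl , n≺n′)) = inj₂ (refl , n≺n′)
⊗-distribʳ-⊕ .to-reflect {inj₁ _ , _} {inj₂ _ , _} _ = inj₁ tt
⊗-distribʳ-⊕ .to-reflect {inj₂ _ , _} {inj₂ _ , _} (inj₁ m≺m′) = inj₁ m≺m′
⊗-distribʳ-⊕ .to-reflect {inj₂ _ , _} {inj₂ _ , _} (inj₂ (refl , n≺n′)) = inj₂ (refl , n≺n′)

suc-· : ∀ p → suc p · L ≅ L ⊕ p · L
suc-· p .to (Fin.zero , x) = inj₁ x
suc-· p .to (Fin.suc i , x) = inj₂ (i , x)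
suc-· p .from (inj₁ x) = Fin.zero , x
suc-· p .from (inj₂ (i , x)) = Fin.suc i , x
suc-· p .from∘to (Fin.zero , _) = refl
suc-· p .from∘to (Fin.suc _ , _) = refl
suc-· p .to∘from (inj₁ _) = refl
suc-· p .to∘from (inj₂ _) = refl
suc-· p .to-mono {Fin.zero , _} {Fin.zero , _} (inj₂ (_ , x≺y)) = x≺y
suc-· p .to-mono {Fin.zero , _} {Fin.suc _ , _} _ = tt
suc-· p .to-mono {Fin.suc _ , _} {Fin.zero , _} (inj₂ (() , _))
suc-· p .to-mono {Fin.suc _ , _} {Fin.suc _ , _} (inj₁ (s≤s i<j)) = inj₁ i<j
suc-· p .to-mono {Fin.suc _ , _} {Fin.suc _ , _} (inj₂ (refl , x≺y)) = inj₂ (refl , x≺y)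
suc-· p .to-reflect {Fin.zero , _} {Fin.zero , _} x≺y = inj₂ (refl , x≺y)
suc-· p .to-reflect {Fin.zero , _} {Fin.suc _ , _} _ = inj₁ (s≤s z≤n)
suc-· p .to-reflect {Fin.suc _ , _} {Fin.suc _ , _} (inj₁ i<j) = inj₁ (s≤s i<j)
suc-· p .to-reflect {Fin.suc _ , _} {Fin.suc _ , _} (inj₂ (refl , x≺y)) = inj₂ (refl , x≺y)

⊕-cmp : Trichotomous _≡_ (_≺_ L) → Trichotomous _≡_ (_≺_ M) → Trichotomous _≡_ (_≺_ (L ⊕ M))
⊕-cmp cmpL cmpM (inj₁ x) (inj₁ y) with cmpL x y
... | tri< a ¬b ¬c = tri< a (¬b ∘ inj₁-injective) ¬c
... | tri≈ ¬a refl ¬c = tri≈ ¬a refl ¬c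
... | tri> ¬a ¬b c = tri> ¬a (¬b ∘ inj₁-injective) c
⊕-cmp cmpL cmpM (inj₁ x) (inj₂ y) = tri< tt (λ ()) (λ ())
⊕-cmp cmpL cmpM (inj₂ x) (inj₁ y) = tri> (λ ()) (λ ()) tt
⊕-cmp cmpL cmpM (inj₂ x) (inj₂ y) with cmpM x y
... | tri< a ¬b ¬c = tri< a (¬b ∘ inj₂-injective) ¬c
... | tri≈ ¬a refl ¬c = tri≈ ¬a refl ¬c
... | tri> ¬a ¬b c = tri> ¬a (¬b ∘ inj₂-injective) c

⊗-cmp : Trichotomous _≡_ (_≺_ L) → Trichotomous _≡_ (_≺_ M) → Trichotomous _≡_ (_≺_ (L ⊗ M))
⊗-cmp cmpL cmpM (l , m) (l′ , m′) with cmpL l l′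
... | tri< l< l≢ l≯ = tri< (inj₁ l<) (l≢ ∘ cong proj₁) λ where
  (inj₁ l>) → l≯ l>
  (inj₂ (refl , _)) → l≢ refl
... | tri> l≮ l≢ l> =
  tri> (λ where (inj₁ l<) → l≮ l< ; (inj₂ (refl , _)) → l≢ refl) (l≢ ∘ cong proj₁) (inj₁ l>)
... | tri≈ l≮ refl l≯ with cmpM m m′
...   | tri< m< m≢ m≯ = tri< (inj₂ (refl , m<)) (m≢ ∘ cong proj₂) λ where
  (inj₁ l>) → l≯ l>
  (inj₂ (_ , m>)) → m≯ m>
...   | tri≈ m≮ refl m≯ = tri≈ (λ where (inj₁ l<) → l≮ l< ; (inj₂ (_ , m<)) → m≮ m<) refl
                              (λ where (inj₁ l>) → l≯ l> ; (inj₂ (_ , m>)) → m≯ m>)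
...   | tri> m≮ m≢ m> =
  tri> (λ where (inj₁ l<) → l≮ l< ; (inj₂ (_ , m<)) → m≮ m<) (m≢ ∘ cong proj₂) (inj₂ (refl , m>))

-- Finite condensation

SimF-sym : ∀ {x y} → SimF L x y → SimF L y x
SimF-sym (zs , cover) = zs , λ z → cover z ∘ Sum.swap

SimF-from : (e : L ≅ M) {x y : Carrier M} → SimF M x y → SimF L (from e x) (from e y)
SimF-from {L} {M} e {x} {y} (zs , cover) = map (from e) zs , cover′
  where
  to-between : ∀ {z} → Between L (from e x) (from e y) z → Between M x y (to e z)
  to-between {z} =
    subst₂ (λ x′ y′ → Between M x′ y′ (to e z)) (to∘from e x) (to∘from e y)
    ∘ Sum.map (Product.map (to-mono e) (to-mono e)) (Product.map (to-mono e) (to-mono e))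
  cover′ : ∀ z → Between L (from e x) (from e y) z → z ∈ map (from e) zs
  cover′ z btw = subst (_∈ map (from e) zs) (from∘to e z) (∈-map⁺ (from e) (cover (to e z) (to-between btw)))

SimF-≅ : (e : L ≅ M) {x y : Carrier L} → SimF L x y ⇔ SimF M (to e x) (to e y)
SimF-≅ {L} e {x} {y} =
  mk⇔ (SimF-from (≅-sym e)) (subst₂ (SimF L) (from∘to e x) (from∘to e y) ∘ SimF-from e)

Condenses-respˡ : L ≅ L′ → Condenses L′ M → Condenses L M
Condenses-respˡ {L} {L′} {M} e (f , surj , ker , ord) = f ∘ to e , surj′ , ker′ , ord′
  where
  surj′ : ∀ u → ∃ λ x → f (to e x) ≡ u
  surj′ u = let x′ , fx′≡u = surj u in from e x′ , trans (cong f (to∘from e x′)) fx′≡u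
  ker′ : ∀ x y → (f (to e x) ≡ f (to e y)) ⇔ SimF L x y
  ker′ x y = ⇔-trans (ker (to e x) (to e y)) (⇔-sym (SimF-≅ e))
  ord′ : ∀ x y → f (to e x) ≺⟨ M ⟩ f (to e y) ⇔ (x ≺⟨ L ⟩ y × ¬ SimF L x y)
  ord′ x y = ⇔-trans (ord (to e x) (to e y))
    (mk⇔ (Product.map (to-reflect e) (_∘ ⇔.to (SimF-≅ e)))
         (Product.map (to-mono e) (_∘ ⇔.from (SimF-≅ e))))

Condenses-respʳ : M ≅ M′ → Condenses L M → Condenses L M′
Condenses-respʳ {M′ = M′} {L = L} e (f , surj , ker , ord) = to e ∘ f , surj′ , ker′ , ord′
  where
  surj′ : ∀ u → ∃ λ x → to e (f x) ≡ u
  surj′ u = Product.map₂ (λ fx≡ → trans (cong (to e) fx≡) (to∘from e u)) (surj (from e u))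
  ker′ : ∀ x y → (to e (f x) ≡ to e (f y)) ⇔ SimF L x y
  ker′ x y = ⇔-trans (mk⇔ (to-injective e) (cong (to e))) (ker x y)
  ord′ : ∀ x y → to e (f x) ≺⟨ M′ ⟩ to e (f y) ⇔ (x ≺⟨ L ⟩ y × ¬ SimF L x y)
  ord′ x y = ⇔-trans (mk⇔ (to-reflect e) (to-mono e)) (ord x y)

module Induced {L M M′ : LO} (c : Condenses L M) (c′ : Condenses L M′) where
  private
    f = proj₁ c
    f′ = proj₁ c′

  pre : Carrier M → Carrier L
  pre u = proj₁ (proj₁ (proj₂ c) u)

  f∘pre : ∀ u → f (pre u) ≡ u
  f∘pre u = proj₂ (proj₁ (proj₂ c) u)

  induced : Carrier M → Carrier M′
  induced = f′ ∘ pre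

  induced-f : ∀ x → induced (f x) ≡ f′ x
  induced-f x = ⇔.from (proj₁ (proj₂ (proj₂ c′)) _ _)
                  (⇔.to (proj₁ (proj₂ (proj₂ c)) _ _) (f∘pre (f x)))

  induced-mono : ∀ {u v} → u ≺⟨ M ⟩ v → induced u ≺⟨ M′ ⟩ induced v
  induced-mono {u} {v} u≺v = ⇔.from (proj₂ (proj₂ (proj₂ c′)) _ _)
    (⇔.to (proj₂ (proj₂ (proj₂ c)) _ _) (subst₂ (Lt M) (sym (f∘pre u)) (sym (f∘pre v)) u≺v))

Condenses-unique : Condenses L M → Condenses L M′ → M ≅ M′
Condenses-unique {L} {M} {M′} c c′ = record
  { to = I.induced ; from = J.induced ; from∘to = J∘I ; to∘from = I∘J
  ; to-mono = I.induced-mono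
  ; to-reflect = λ {u} {v} h → subst₂ (Lt M) (J∘I u) (J∘I v) (J.induced-mono h)
  }
  where
  module I = Induced {L} {M} {M′} c c′
  module J = Induced {L} {M′} {M} c′ c
  J∘I : ∀ u → J.induced (I.induced u) ≡ u
  J∘I u = trans (J.induced-f (I.pre u)) (I.f∘pre u)
  I∘J : ∀ u → I.induced (J.induced u) ≡ u
  I∘J u = trans (I.induced-f (J.pre u)) (J.f∘pre u)

fresh-above : ∀ k (ns : List ℕ) → ∃ λ j → k < j × j ∉ ns
fresh-above k ns =
  suc (max k ns) , s≤s (⊥≤max k ns) , λ j∈ns → <-irrefl refl (All.lookup (xs≤max k ns) j∈ns)

module _ {M : LO} (cmp : Trichotomous _≡_ (_≺_ M)) where

  private
    Mω = M ⊗ ωLO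

  fibre-between : ∀ {u v k j k′}
    → (u , k) ≺⟨ Mω ⟩ (v , j) → (v , j) ≺⟨ Mω ⟩ (u , k′) → v ≡ u × j < k′
  fibre-between (inj₁ u≺v) (inj₁ v≺u) = ⊥-elim (tri⇒asym cmp u≺v v≺u)
  fibre-between (inj₁ u≺u) (inj₂ (refl , _)) = ⊥-elim (tri⇒irr cmp refl u≺u)
  fibre-between (inj₂ (refl , _)) (inj₁ u≺u) = ⊥-elim (tri⇒irr cmp refl u≺u)
  fibre-between (inj₂ (refl , _)) (inj₂ (refl , j<k′)) = refl , j<k′

  fibre-SimF : ∀ {u k k′} → SimF Mω (u , k) (u , k′)
  fibre-SimF {u} {k} {k′} = map (u ,_) (upTo (k ⊔ k′)) , cover
    where
    cover : ∀ z → Between Mω (u , k) (u , k′) z → z ∈ map (u ,_) (upTo (k ⊔ k′))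
    cover (v , j) (inj₁ (lo , hi)) with fibre-between lo hi
    ... | refl , j<k′ = ∈-map⁺ (u ,_) (∈-upTo⁺ (<-≤-trans j<k′ (m≤n⊔m k k′)))
    cover (v , j) (inj₂ (lo , hi)) with fibre-between lo hi
    ... | refl , j<k = ∈-map⁺ (u ,_) (∈-upTo⁺ (<-≤-trans j<k (m≤m⊔n k k′)))

  gap-¬SimF : ∀ {u u′ k k′} → u ≺⟨ M ⟩ u′ → ¬ SimF Mω (u , k) (u′ , k′)
  gap-¬SimF {u} {k = k} u≺u′ (zs , cover) =
    let j , k<j , j∉ = fresh-above k (map proj₂ zs)
    in j∉ (∈-map⁺ proj₂ (cover (u , j) (inj₁ (inj₂ (refl , k<j) , inj₁ u≺u′))))

  SimF⇒≡ : ∀ {u u′ k k′} → SimF Mω (u , k) (u′ , k′) → u ≡ u′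
  SimF⇒≡ {u} {u′} s with cmp u u′
  ... | tri< u≺u′ _ _ = ⊥-elim (gap-¬SimF u≺u′ s)
  ... | tri≈ _ u≡u′ _ = u≡u′
  ... | tri> _ _ u′≺u = ⊥-elim (gap-¬SimF u′≺u (SimF-sym {L = Mω} s))

  ⊗ω-condenses : Condenses Mω M
  ⊗ω-condenses = proj₁ , (λ u → (u , 0) , refl) , kernel , order
    where
    kernel : ∀ x y → (proj₁ x ≡ proj₁ y) ⇔ SimF Mω x y
    kernel (u , k) (u′ , k′) = mk⇔ (λ { refl → fibre-SimF }) SimF⇒≡
    order : ∀ x y → proj₁ x ≺⟨ M ⟩ proj₁ y ⇔ (x ≺⟨ Mω ⟩ y × ¬ SimF Mω x y)
    order (u , k) (u′ , k′) = mk⇔ (λ u≺u′ → inj₁ u≺u′ , gap-¬SimF u≺u′) λ where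
      (inj₁ u≺u′ , _) → u≺u′
      (inj₂ (refl , _) , ¬s) → ⊥-elim (¬s fibre-SimF)

·⊗ω-⊕-condenses : Trichotomous _≡_ (_≺_ L) → Trichotomous _≡_ (_≺_ M) → ∀ p q
  → Condenses (p · (L ⊗ ωLO) ⊕ q · (M ⊗ ωLO)) (p · L ⊕ q · M)
·⊗ω-⊕-condenses {L} {M} cmpL cmpM p q =
  Condenses-respˡ {M = p · L ⊕ q · M}
    (≅-trans (⊕-cong (≅-sym ⊗-assoc) (≅-sym ⊗-assoc)) (≅-sym ⊗-distribʳ-⊕))
    (⊗ω-condenses (⊕-cmp (⊗-cmp Finₚ.<-cmp cmpL) (⊗-cmp Finₚ.<-cmp cmpM)))

variable
  K k l : ℕ

-- Ordinals below ω^K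

-- The vector (c_{K-1}, …, c_0) codes the ordinal ω^(K-1) c_{K-1} + ⋯ + c_0 < ω^K.
_<ₗₑₓ_ : Vec ℕ K → Vec ℕ K → Set
[] <ₗₑₓ [] = ⊥
(x ∷ xs) <ₗₑₓ (y ∷ ys) = x < y ⊎ (x ≡ y × xs <ₗₑₓ ys)

infix 4 _<ₗₑₓ_

<ₗₑₓ-cmp : Trichotomous _≡_ (_<ₗₑₓ_ {K})
<ₗₑₓ-cmp [] [] = tri≈ id refl id
<ₗₑₓ-cmp (x ∷ xs) (y ∷ ys) with <-cmp x y
... | tri< x< x≢ x≯ = tri< (inj₁ x<) (x≢ ∘ proj₁ ∘ ∷-injective) λ where
  (inj₁ x>) → x≯ x>
  (inj₂ (refl , _)) → x≢ refl
... | tri> x≮ x≢ x> =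
  tri> (λ where (inj₁ x<) → x≮ x< ; (inj₂ (refl , _)) → x≢ refl) (x≢ ∘ proj₁ ∘ ∷-injective) (inj₁ x>)
... | tri≈ x≮ refl x≯ with <ₗₑₓ-cmp xs ys
...   | tri< xs< xs≢ xs≯ = tri< (inj₂ (refl , xs<)) (xs≢ ∘ proj₂ ∘ ∷-injective) λ where
  (inj₁ x>) → x≯ x>
  (inj₂ (_ , xs>)) → xs≯ xs>
...   | tri≈ xs≮ refl xs≯ = tri≈ (λ where (inj₁ x<) → x≮ x< ; (inj₂ (_ , xs<)) → xs≮ xs<) refl
                                (λ where (inj₁ x>) → x≯ x> ; (inj₂ (_ , xs>)) → xs≯ xs>)
...   | tri> xs≮ xs≢ xs> = tri> (λ where (inj₁ x<) → x≮ x< ; (inj₂ (_ , xs<)) → xs≮ xs<)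
                             (xs≢ ∘ proj₂ ∘ ∷-injective) (inj₂ (refl , xs>))

<ₗₑₓ-irrelevant : {xs ys : Vec ℕ K} (h h′ : xs <ₗₑₓ ys) → h ≡ h′
<ₗₑₓ-irrelevant {xs = []} {[]} ()
<ₗₑₓ-irrelevant {xs = _ ∷ _} {_ ∷ _} (inj₁ x<) (inj₁ x<′) = cong inj₁ (<-irrelevant x< x<′)
<ₗₑₓ-irrelevant {xs = _ ∷ _} {_ ∷ _} (inj₁ x<) (inj₂ (refl , _)) = ⊥-elim (<-irrefl refl x<)
<ₗₑₓ-irrelevant {xs = _ ∷ _} {_ ∷ _} (inj₂ (refl , _)) (inj₁ x<) = ⊥-elim (<-irrefl refl x<)
<ₗₑₓ-irrelevant {xs = _ ∷ _} {_ ∷ _} (inj₂ (refl , h)) (inj₂ (refl , h′)) =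
  cong (λ h → inj₂ (refl , h)) (<ₗₑₓ-irrelevant h h′)

<ₗₑₓ-asym : {xs ys : Vec ℕ K} → xs <ₗₑₓ ys → ¬ ys <ₗₑₓ xs
<ₗₑₓ-asym = tri⇒asym <ₗₑₓ-cmp

∷ʳ-<ₗₑₓ : {xs ys : Vec ℕ K} {x y : ℕ}
  → xs ∷ʳ x <ₗₑₓ ys ∷ʳ y ⇔ (xs <ₗₑₓ ys ⊎ (xs ≡ ys × x < y))
∷ʳ-<ₗₑₓ = mk⇔ forward backward
  where
  forward : {xs ys : Vec ℕ K} {x y : ℕ}
    → xs ∷ʳ x <ₗₑₓ ys ∷ʳ y → xs <ₗₑₓ ys ⊎ (xs ≡ ys × x < y)
  forward {xs = []} {[]} (inj₁ x<y) = inj₂ (refl , x<y)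
  forward {xs = _ ∷ _} {_ ∷ _} (inj₁ x<y) = inj₁ (inj₁ x<y)
  forward {xs = _ ∷ _} {_ ∷ _} (inj₂ (refl , h)) =
    Sum.map (λ xs< → inj₂ (refl , xs<)) (Product.map₁ (cong (_ ∷_))) (forward h)
  backward : {xs ys : Vec ℕ K} {x y : ℕ}
    → xs <ₗₑₓ ys ⊎ (xs ≡ ys × x < y) → xs ∷ʳ x <ₗₑₓ ys ∷ʳ y
  backward {xs = []} {[]} (inj₂ (_ , x<y)) = inj₁ x<y
  backward {xs = _ ∷ _} {_ ∷ _} (inj₁ (inj₁ x<y)) = inj₁ x<y
  backward {xs = _ ∷ _} {_ ∷ _} (inj₁ (inj₂ (refl , xs<))) = inj₂ (refl , backward (inj₁ xs<))
  backward {xs = _ ∷ _} {_ ∷ _} (inj₂ (refl , x<y)) = inj₂ (refl , backward (inj₂ (refl , x<y)))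

init∷ʳlast : (xs : Vec ℕ (suc K)) → xs ≡ init xs ∷ʳ last xs
init∷ʳlast xs = proj₂ (proj₂ (initLast xs))

<ₗₑₓ-init-last : {xs ys : Vec ℕ (suc K)}
  → xs <ₗₑₓ ys ⇔ (init xs <ₗₑₓ init ys ⊎ (init xs ≡ init ys × last xs < last ys))
<ₗₑₓ-init-last {xs = xs} {ys} =
  subst₂ (λ u v → u <ₗₑₓ v ⇔ (init xs <ₗₑₓ init ys ⊎ (init xs ≡ init ys × last xs < last ys)))
         (sym (init∷ʳlast xs)) (sym (init∷ʳlast ys)) ∷ʳ-<ₗₑₓ

Below : Vec ℕ K → LO
Below {K} β = record { Carrier = Σ (Vec ℕ K) (_<ₗₑₓ β) ; _≺_ = λ x y → proj₁ x <ₗₑₓ proj₁ y }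

below-≡ : {β : Vec ℕ K} {x y : Carrier (Below β)} → proj₁ x ≡ proj₁ y → x ≡ y
below-≡ {x = γ , h} {.γ , h′} refl = cong (γ ,_) (<ₗₑₓ-irrelevant h h′)

Below-cmp : {β : Vec ℕ K} → Trichotomous _≡_ (_≺_ (Below β))
Below-cmp (γ , _) (δ , _) with <ₗₑₓ-cmp γ δ
... | tri< a ¬b ¬c = tri< a (¬b ∘ cong proj₁) ¬c
... | tri≈ ¬a b ¬c = tri≈ ¬a (below-≡ b) ¬c
... | tri> ¬a ¬b c = tri> ¬a (¬b ∘ cong proj₁) c

Below-cong : {β γ : Vec ℕ K} → β ≡ γ → Below β ≅ Below γ
Below-cong refl = ≅-refl

init-<ₗₑₓ : {γ : Vec ℕ (suc K)} {β : Vec ℕ K} → γ <ₗₑₓ β ∷ʳ 0 → init γ <ₗₑₓ β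
init-<ₗₑₓ {γ = γ} {β} γ< with ⇔.to ∷ʳ-<ₗₑₓ (subst (_<ₗₑₓ β ∷ʳ 0) (init∷ʳlast γ) γ<)
... | inj₁ init< = init<
... | inj₂ (_ , last<0) = ⊥-elim (n≮0 last<0)

-- Appending a zero coefficient raises every exponent by one, which replaces each
-- point of β by a copy of ω.
Below-∷ʳ0 : {β : Vec ℕ K} → Below (β ∷ʳ 0) ≅ Below β ⊗ ωLO
Below-∷ʳ0 .to (γ , γ<) = (init γ , init-<ₗₑₓ γ<) , last γ
Below-∷ʳ0 .from ((δ , δ<) , k) = δ ∷ʳ k , ⇔.from ∷ʳ-<ₗₑₓ (inj₁ δ<)
Below-∷ʳ0 .from∘to (γ , _) = below-≡ (sym (init∷ʳlast γ))
Below-∷ʳ0 .to∘from ((δ , _) , k) = cong₂ _,_ (below-≡ (init-∷ʳ k δ)) (last-∷ʳ k δ)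
Below-∷ʳ0 .to-mono γ<δ = Sum.map₂ (Product.map₁ below-≡) (⇔.to <ₗₑₓ-init-last γ<δ)
Below-∷ʳ0 .to-reflect h = ⇔.from <ₗₑₓ-init-last (Sum.map₂ (Product.map₁ (cong proj₁)) h)

zeros : Vec ℕ K
zeros = replicate _ 0

≮zeros : (γ : Vec ℕ K) → ¬ γ <ₗₑₓ zeros
≮zeros (_ ∷ _) (inj₁ ())
≮zeros (_ ∷ γ) (inj₂ (_ , γ<)) = ≮zeros γ γ<

-- Ordinal addition: below the leading nonzero coefficient of the right summand,
-- the left summand is absorbed (ω^i + ω^j = ω^j for i < j).
_+ₒ_ : Vec ℕ K → Vec ℕ K → Vec ℕ K
[] +ₒ [] = []
(x ∷ xs) +ₒ (zero ∷ ys) = x ∷ (xs +ₒ ys)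
(x ∷ xs) +ₒ (suc y ∷ ys) = (x + suc y) ∷ ys

infixl 6 _+ₒ_

+ₒ-identityˡ : (γ : Vec ℕ K) → zeros +ₒ γ ≡ γ
+ₒ-identityˡ [] = refl
+ₒ-identityˡ (zero ∷ γ) = cong (0 ∷_) (+ₒ-identityˡ γ)
+ₒ-identityˡ (suc _ ∷ _) = refl

+ₒ-identityʳ : (γ : Vec ℕ K) → γ +ₒ zeros ≡ γ
+ₒ-identityʳ [] = refl
+ₒ-identityʳ (x ∷ γ) = cong (x ∷_) (+ₒ-identityʳ γ)

∷-+ₒ-∷ : ∀ {x y} {xs ys : Vec ℕ K} → y ≢ 0 → (x ∷ xs) +ₒ (y ∷ ys) ≡ (x + y) ∷ ys
∷-+ₒ-∷ {y = zero} y≢0 = ⊥-elim (y≢0 refl)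
∷-+ₒ-∷ {y = suc _} _ = refl

<ₗₑₓ-+ₒ : {γ β : Vec ℕ K} (δ : Vec ℕ K) → γ <ₗₑₓ β → γ <ₗₑₓ β +ₒ δ
<ₗₑₓ-+ₒ {γ = []} {[]} [] ()
<ₗₑₓ-+ₒ {γ = _ ∷ _} {_ ∷ _} (zero ∷ δ) (inj₁ g<b) = inj₁ g<b
<ₗₑₓ-+ₒ {γ = _ ∷ _} {_ ∷ _} (zero ∷ δ) (inj₂ (refl , γ<)) = inj₂ (refl , <ₗₑₓ-+ₒ δ γ<)
<ₗₑₓ-+ₒ {γ = _ ∷ _} {b ∷ _} (suc d ∷ δ) (inj₁ g<b) = inj₁ (<-≤-trans g<b (m≤m+n b (suc d)))
<ₗₑₓ-+ₒ {γ = _ ∷ _} {b ∷ _} (suc d ∷ δ) (inj₂ (refl , _)) = inj₁ (m<m+n b z<s)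

+ₒ-≮ : (β δ : Vec ℕ K) → ¬ β +ₒ δ <ₗₑₓ β
+ₒ-≮ [] [] ()
+ₒ-≮ (b ∷ β) (zero ∷ δ) (inj₁ b<b) = <-irrefl refl b<b
+ₒ-≮ (b ∷ β) (zero ∷ δ) (inj₂ (_ , h)) = +ₒ-≮ β δ h
+ₒ-≮ (b ∷ β) (suc d ∷ δ) (inj₁ h) = <-irrefl refl (<-≤-trans h (m≤m+n b (suc d)))
+ₒ-≮ (b ∷ β) (suc d ∷ δ) (inj₂ (e , _)) = <-irrefl (sym e) (m<m+n b z<s)

+ₒ-monoʳ-< : (β : Vec ℕ K) {δ δ′ : Vec ℕ K} → δ <ₗₑₓ δ′ → β +ₒ δ <ₗₑₓ β +ₒ δ′
+ₒ-monoʳ-< [] {[]} {[]} ()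
+ₒ-monoʳ-< (b ∷ β) {zero ∷ _} {zero ∷ _} (inj₂ (_ , δ<)) = inj₂ (refl , +ₒ-monoʳ-< β δ<)
+ₒ-monoʳ-< (b ∷ β) {zero ∷ _} {suc _ ∷ _} _ = inj₁ (m<m+n b z<s)
+ₒ-monoʳ-< (b ∷ β) {suc _ ∷ _} {zero ∷ _} (inj₂ (() , _))
+ₒ-monoʳ-< (b ∷ β) {suc _ ∷ _} {suc _ ∷ _} (inj₁ d<d′) = inj₁ (+-monoʳ-< b d<d′)
+ₒ-monoʳ-< (b ∷ β) {suc _ ∷ _} {suc _ ∷ _} (inj₂ (refl , δ<)) = inj₂ (refl , δ<)

+ₒ-cancelˡ-< : (β : Vec ℕ K) {δ δ′ : Vec ℕ K} → β +ₒ δ <ₗₑₓ β +ₒ δ′ → δ <ₗₑₓ δ′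
+ₒ-cancelˡ-< β {δ} {δ′} h with <ₗₑₓ-cmp δ δ′
... | tri< δ< _ _ = δ<
... | tri≈ _ refl _ = ⊥-elim (tri⇒irr <ₗₑₓ-cmp refl h)
... | tri> _ _ δ> = ⊥-elim (<ₗₑₓ-asym h (+ₒ-monoʳ-< β δ>))

+ₒ-cancelˡ-≡ : (β : Vec ℕ K) {δ δ′ : Vec ℕ K} → β +ₒ δ ≡ β +ₒ δ′ → δ ≡ δ′
+ₒ-cancelˡ-≡ β {δ} {δ′} e with <ₗₑₓ-cmp δ δ′
... | tri< δ< _ _ = ⊥-elim (tri⇒irr <ₗₑₓ-cmp e (+ₒ-monoʳ-< β δ<))
... | tri≈ _ δ≡ _ = δ≡
... | tri> _ _ δ> = ⊥-elim (tri⇒irr <ₗₑₓ-cmp (sym e) (+ₒ-monoʳ-< β δ>))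

+ₒ-split : (β γ : Vec ℕ K) → ¬ γ <ₗₑₓ β → ∃ λ δ → β +ₒ δ ≡ γ
+ₒ-split [] [] _ = [] , refl
+ₒ-split (b ∷ β) (g ∷ γ) γ≮ with <-cmp b g
... | tri< b<g _ _ = let d , b+d≡g = m≤n⇒∃[o]m+o≡n b<g in suc d ∷ γ , cong (_∷ γ) (trans (+-suc b d) b+d≡g)
... | tri≈ _ refl _ =
  let δ , β+δ≡γ = +ₒ-split β γ (γ≮ ∘ λ γ< → inj₂ (refl , γ<)) in 0 ∷ δ , cong (g ∷_) β+δ≡γ
... | tri> _ _ g<b = ⊥-elim (γ≮ (inj₁ g<b))

module _ {β γ : Vec ℕ K} where

  private
    split-below : (δ : Vec ℕ K) → δ <ₗₑₓ β +ₒ γ → Carrier (Below β ⊕ Below γ)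
    split-below δ δ< with tri⇒dec< <ₗₑₓ-cmp δ β
    ... | yes δ<β = inj₁ (δ , δ<β)
    ... | no δ≮β = let ε , β+ε≡δ = +ₒ-split β δ δ≮β
                   in inj₂ (ε , +ₒ-cancelˡ-< β (subst (_<ₗₑₓ β +ₒ γ) (sym β+ε≡δ) δ<))

    join : Carrier (Below β ⊕ Below γ) → Vec ℕ K
    join (inj₁ (δ , _)) = δ
    join (inj₂ (ε , _)) = β +ₒ ε

    join< : ∀ x → join x <ₗₑₓ β +ₒ γ
    join< (inj₁ (δ , δ<β)) = <ₗₑₓ-+ₒ γ δ<β
    join< (inj₂ (ε , ε<γ)) = +ₒ-monoʳ-< β ε<γ

    join-split : ∀ δ δ< → join (split-below δ δ<) ≡ δ
    join-split δ δ< with tri⇒dec< <ₗₑₓ-cmp δ β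
    ... | yes _ = refl
    ... | no δ≮β = proj₂ (+ₒ-split β δ δ≮β)

    split-join : ∀ x x< → split-below (join x) x< ≡ x
    split-join (inj₁ (δ , δ<β)) _ with tri⇒dec< <ₗₑₓ-cmp δ β
    ... | yes _ = cong inj₁ (below-≡ refl)
    ... | no δ≮β = ⊥-elim (δ≮β δ<β)
    split-join (inj₂ (ε , _)) _ with tri⇒dec< <ₗₑₓ-cmp (β +ₒ ε) β
    ... | yes β+ε<β = ⊥-elim (+ₒ-≮ β ε β+ε<β)
    ... | no β+ε≮β = cong inj₂ (below-≡ (+ₒ-cancelˡ-≡ β (proj₂ (+ₒ-split β (β +ₒ ε) β+ε≮β))))

  Below-+ₒ : Below β ⊕ Below γ ≅ Below (β +ₒ γ)
  Below-+ₒ .to x = join x , join< x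
  Below-+ₒ .from (δ , δ<) = split-below δ δ<
  Below-+ₒ .from∘to x = split-join x _
  Below-+ₒ .to∘from (δ , δ<) = below-≡ (join-split δ δ<)
  Below-+ₒ .to-mono {inj₁ _} {inj₁ _} δ<δ′ = δ<δ′
  Below-+ₒ .to-mono {inj₁ (δ , δ<β)} {inj₂ (ε , _)} _ = <ₗₑₓ-+ₒ ε δ<β
  Below-+ₒ .to-mono {inj₂ _} {inj₂ _} ε<ε′ = +ₒ-monoʳ-< β ε<ε′
  Below-+ₒ .to-reflect {inj₁ _} {inj₁ _} δ<δ′ = δ<δ′
  Below-+ₒ .to-reflect {inj₁ _} {inj₂ _} _ = tt
  Below-+ₒ .to-reflect {inj₂ (ε , _)} {inj₁ (δ , δ<β)} β+ε<δ = <ₗₑₓ-asym β+ε<δ (<ₗₑₓ-+ₒ ε δ<β)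
  Below-+ₒ .to-reflect {inj₂ _} {inj₂ _} h = +ₒ-cancelˡ-< β h

_·ₒ_ : ℕ → Vec ℕ K → Vec ℕ K
zero ·ₒ β = zeros
suc p ·ₒ β = β +ₒ p ·ₒ β

infixl 7 _·ₒ_

·ₒ-lead : ∀ p {x} {xs : Vec ℕ K} → x ≢ 0 → suc p ·ₒ (x ∷ xs) ≡ (suc p * x) ∷ xs
·ₒ-lead _ {zero} x≢0 = ⊥-elim (x≢0 refl)
·ₒ-lead zero {suc x} {xs} _ = cong₂ _∷_ (sym (+-identityʳ (suc x))) (+ₒ-identityʳ xs)
·ₒ-lead (suc p) {suc x} {xs} x≢0 = cong (λ v → (suc x ∷ xs) +ₒ v) (·ₒ-lead p x≢0)

Below-·ₒ : ∀ p {β : Vec ℕ K} → p · Below β ≅ Below (p ·ₒ β)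
Below-·ₒ zero = empty-≅ (λ ()) (λ (γ , γ<) → ≮zeros γ γ<)
Below-·ₒ (suc p) = ≅-trans (suc-· p) (≅-trans (⊕-cong ≅-refl (Below-·ₒ p)) Below-+ₒ)

Below-0∷ : {β : Vec ℕ K} → Below β ≅ Below (0 ∷ β)
Below-0∷ .to (γ , γ<) = 0 ∷ γ , inj₂ (refl , γ<)
Below-0∷ .from (zero ∷ γ , inj₂ (_ , γ<)) = γ , γ<
Below-0∷ .from∘to _ = refl
Below-0∷ .to∘from (zero ∷ _ , inj₂ (refl , _)) = refl
Below-0∷ .to-mono γ<δ = inj₂ (refl , γ<δ)
Below-0∷ .to-reflect (inj₂ (_ , γ<δ)) = γ<δ

pad : k ≤′ K → Vec ℕ k → Vec ℕ K
pad ≤′-refl β = β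
pad (≤′-step k≤K) β = 0 ∷ pad k≤K β

Below-pad : (k≤K : k ≤′ K) {β : Vec ℕ k} → Below β ≅ Below (pad k≤K β)
Below-pad ≤′-refl = ≅-refl
Below-pad (≤′-step k≤K) = ≅-trans (Below-pad k≤K) Below-0∷

-- Cantor normal forms

ωpow→Vec : ∀ k → Carrier (ωpow k) → Vec ℕ k
ωpow→Vec zero _ = []
ωpow→Vec (suc k) (n , w) = n ∷ ωpow→Vec k w

Vec→ωpow : ∀ k → Vec ℕ k → Carrier (ωpow k)
Vec→ωpow zero _ = tt
Vec→ωpow (suc k) (n ∷ γ) = n , Vec→ωpow k γ

ωpow→Vec→ωpow : ∀ k w → Vec→ωpow k (ωpow→Vec k w) ≡ w
ωpow→Vec→ωpow zero _ = refl
ωpow→Vec→ωpow (suc k) (n , w) = cong (n ,_) (ωpow→Vec→ωpow k w)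

Vec→ωpow→Vec : ∀ k γ → ωpow→Vec k (Vec→ωpow k γ) ≡ γ
Vec→ωpow→Vec zero [] = refl
Vec→ωpow→Vec (suc k) (n ∷ γ) = cong (n ∷_) (Vec→ωpow→Vec k γ)

ωpow→Vec-<ₗₑₓ : ∀ k {w w′} → w ≺⟨ ωpow k ⟩ w′ ⇔ ωpow→Vec k w <ₗₑₓ ωpow→Vec k w′
ωpow→Vec-<ₗₑₓ zero = mk⇔ id id
ωpow→Vec-<ₗₑₓ (suc k) =
  mk⇔ (Sum.map₂ (Product.map₂ (⇔.to (ωpow→Vec-<ₗₑₓ k))))
      (Sum.map₂ (Product.map₂ (⇔.from (ωpow→Vec-<ₗₑₓ k))))

below-1∷zeros : {γ : Vec ℕ (suc k)} → γ <ₗₑₓ 1 ∷ zeros → 0 ∷ tail γ ≡ γ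
below-1∷zeros {γ = zero ∷ _} _ = refl
below-1∷zeros {γ = suc _ ∷ γ} (inj₂ (refl , γ<)) = ⊥-elim (≮zeros γ γ<)
below-1∷zeros {γ = suc _ ∷ γ} (inj₁ (s≤s ()))

ωpow≅Below : ∀ k → ωpow k ≅ Below (1 ∷ zeros {k})
ωpow≅Below k .to w = 0 ∷ ωpow→Vec k w , inj₁ z<s
ωpow≅Below k .from (γ , _) = Vec→ωpow k (tail γ)
ωpow≅Below k .from∘to = ωpow→Vec→ωpow k
ωpow≅Below k .to∘from (γ , γ<) =
  below-≡ (trans (cong (0 ∷_) (Vec→ωpow→Vec k (tail γ))) (below-1∷zeros γ<))
ωpow≅Below k .to-mono w<w′ = inj₂ (refl , ⇔.to (ωpow→Vec-<ₗₑₓ k) w<w′)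
ωpow≅Below k .to-reflect (inj₂ (_ , h)) = ⇔.from (ωpow→Vec-<ₗₑₓ k) h

term≅Below : ∀ c k → term c k ≅ Below (c ∷ zeros {k})
term≅Below c k = ≅-trans (⊗-congˡ (ωpow≅Below k)) (≅-trans (Below-·ₒ c) (Below-cong (·ₒ-1∷zeros c)))
  where
  ·ₒ-1∷zeros : ∀ c → c ·ₒ (1 ∷ zeros {k}) ≡ c ∷ zeros
  ·ₒ-1∷zeros zero = refl
  ·ₒ-1∷zeros (suc c) = trans (·ₒ-lead c (λ ())) (cong (_∷ zeros) (*-identityʳ (suc c)))

term-⊕≅Below : ∀ c j {v : Vec ℕ (suc j)} → L ≅ Below v → term c (suc j) ⊕ L ≅ Below (c ∷ v)
term-⊕≅Below c j {v} e =
  ≅-trans (⊕-cong (term≅Below c (suc j)) (≅-trans e Below-0∷))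
          (≅-trans Below-+ₒ (Below-cong (cong (c ∷_) (+ₒ-identityˡ v))))

coeffs : (ℕ → ℕ) → (K : ℕ) → Vec ℕ K
coeffs f zero = []
coeffs f (suc K) = f K ∷ coeffs f K

cnf≅Below : ∀ a j → cnf a j ≅ Below (coeffs a (suc j))
cnf≅Below a zero = term≅Below (a 0) 0
cnf≅Below a (suc j) = term-⊕≅Below (a (suc j)) j (cnf≅Below a j)

coeffs-∷ʳ : ∀ f K → coeffs f (suc K) ≡ coeffs (f ∘ suc) K ∷ʳ f 0
coeffs-∷ʳ f zero = refl
coeffs-∷ʳ f (suc K) = cong (f (suc K) ∷_) (coeffs-∷ʳ f K)

cnf≅Below⊗ω : ∀ {a} → a 0 ≡ 0 → ∀ j → cnf a j ≅ Below (coeffs (a ∘ suc) j) ⊗ ωLO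
cnf≅Below⊗ω {a} a₀≡0 j =
  ≅-trans (cnf≅Below a j)
    (≅-trans (Below-cong (trans (coeffs-∷ʳ a j) (cong (coeffs (a ∘ suc) j ∷ʳ_) a₀≡0))) Below-∷ʳ0)

coeffs-cong : ∀ {f g} K → (∀ i → i < K → f i ≡ g i) → coeffs f K ≡ coeffs g K
coeffs-cong zero _ = refl
coeffs-cong (suc K) f≗g = cong₂ _∷_ (f≗g K ≤-refl) (coeffs-cong K (λ i i<K → f≗g i (m<n⇒m<1+n i<K)))

+ₒ-pad-coeffs : ∀ {f g h y} (k<K : suc k ≤′ K) → y ≢ 0
  → (∀ i → i < k → h i ≡ g i) → h k ≡ f k + y → (∀ i → k < i → i < K → h i ≡ f i)
  → coeffs f K +ₒ pad k<K (y ∷ coeffs g k) ≡ coeffs h K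
+ₒ-pad-coeffs {k = k} ≤′-refl y≢0 low mid _ =
  trans (∷-+ₒ-∷ y≢0) (cong₂ _∷_ (sym mid) (coeffs-cong k (λ i i<k → sym (low i i<k))))
+ₒ-pad-coeffs {K = suc K} (≤′-step k<K) y≢0 low mid high =
  cong₂ _∷_ (sym (high K (≤′⇒≤ k<K) ≤-refl))
            (+ₒ-pad-coeffs k<K y≢0 low mid (λ i k<i i<K → high i k<i (m<n⇒m<1+n i<K)))

module MergeCoeff (a b : ℕ → ℕ) (m q : ℕ) where

  mergeCoeff-< : ∀ {i} → i < m ∸ 1 → mergeCoeff a b m q i ≡ b (suc i)
  mergeCoeff-< {i} i< with i <ᵇ (m ∸ 1) | <ᵇ-reflects-< i (m ∸ 1)
  ... | true | _ = refl
  ... | false | ofⁿ i≮ = contradiction i< i≮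

  mergeCoeff-≡ : mergeCoeff a b m q (m ∸ 1) ≡ a m + q * b m
  mergeCoeff-≡ with (m ∸ 1) <ᵇ (m ∸ 1) | <ᵇ-reflects-< (m ∸ 1) (m ∸ 1)
  ... | true | ofʸ i<i = ⊥-elim (<-irrefl refl i<i)
  ... | false | _ with (m ∸ 1) ≡ᵇ (m ∸ 1) | ≡⇒≡ᵇ (m ∸ 1) (m ∸ 1) refl
  ...   | true | _ = refl

  mergeCoeff-> : ∀ {i} → m ∸ 1 < i → mergeCoeff a b m q i ≡ a (suc i)
  mergeCoeff-> {i} i> with i <ᵇ (m ∸ 1) | <ᵇ-reflects-< i (m ∸ 1)
  ... | true | ofʸ i< = ⊥-elim (<-asym i< i>)
  ... | false | _ with i ≡ᵇ (m ∸ 1) | ≡ᵇ⇒≡ i (m ∸ 1)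
  ...   | true | i≡ = ⊥-elim (<-irrefl (sym (i≡ tt)) i>)
  ...   | false | _ = refl

⊕≅term-⊕-cnf : ∀ {c g j} {u : Vec ℕ k} {v : Vec ℕ l} (k≤ : k ≤′ suc (suc j)) (l≤ : l ≤′ suc (suc j))
  → L ≅ Below u → M ≅ Below v → pad k≤ u +ₒ pad l≤ v ≡ c ∷ coeffs g (suc j)
  → L ⊕ M ≅ term c (suc j) ⊕ cnf g j
⊕≅term-⊕-cnf {c = c} {g} {j} k≤ l≤ e f sum≡ =
  ≅-trans (⊕-cong (≅-trans e (Below-pad k≤)) (≅-trans f (Below-pad l≤)))
    (≅-trans Below-+ₒ (≅-trans (Below-cong sum≡) (≅-sym (term-⊕≅Below c j (cnf≅Below g j)))))

suc*≢0 : ∀ p {x} → x ≢ 0 → suc p * x ≢ 0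
suc*≢0 p x≢0 = Sum.[ (λ ()) , x≢0 ] ∘ m*n≡0⇒m≡0∨n≡0 (suc p)

·Below-coeffs : ∀ p {f} K → f K ≢ 0 → suc p · Below (coeffs f (suc K)) ≅ Below (suc p * f K ∷ coeffs f K)
·Below-coeffs p K fK≢0 = ≅-trans (Below-·ₒ (suc p)) (Below-cong (·ₒ-lead p fK≢0))

cnf-condenses : ∀ {a} n → a 0 ≡ 0 → Condenses (cnf a n) (Below (coeffs (a ∘ suc) n))
cnf-condenses {a} n a₀≡0 =
  Condenses-respˡ {M = Below (coeffs (a ∘ suc) n)} (cnf≅Below⊗ω a₀≡0 n) (⊗ω-condenses Below-cmp)

·cnf-⊕-·cnf-condenses : ∀ {a b} n m p q → a 0 ≡ 0 → b 0 ≡ 0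
  → Condenses (p · cnf a n ⊕ q · cnf b m) (p · Below (coeffs (a ∘ suc) n) ⊕ q · Below (coeffs (b ∘ suc) m))
·cnf-⊕-·cnf-condenses {a} {b} n m p q a₀≡0 b₀≡0 =
  Condenses-respˡ {M = p · Below (coeffs (a ∘ suc) n) ⊕ q · Below (coeffs (b ∘ suc) m)}
    (⊕-cong (⊗-congˡ (cnf≅Below⊗ω a₀≡0 n)) (⊗-congˡ (cnf≅Below⊗ω b₀≡0 m)))
    (·⊗ω-⊕-condenses Below-cmp Below-cmp p q)

mainTheorem2 : (n m : ℕ) (a b : ℕ → ℕ) (p q : ℕ)
  → 2 ≤ n → 2 ≤ m → a n ≢ 0 → b m ≢ 0 → a 0 ≡ 0 → b 0 ≡ 0
  → p ≢ 0 → q ≢ 0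
  → ((A B : LO) → Condenses (cnf a n) A → Condenses (cnf b m) B
       → Condenses (p · cnf a n ⊕ q · cnf b m) (p · A ⊕ q · B))
    × (n < m → Condenses (p · cnf a n ⊕ q · cnf b m)
                 (term (q * b m) (m ∸ 1) ⊕ cnf (λ k → b (1 + k)) (m ∸ 2)))
    × (n ≡ m → Condenses (p · cnf a n ⊕ q · cnf b m)
                 (term (p * a n + q * b n) (n ∸ 1) ⊕ cnf (λ k → b (1 + k)) (n ∸ 2)))
    × (n > m → Condenses (p · cnf a n ⊕ q · cnf b m)
                 (term (p * a n) (n ∸ 1) ⊕ cnf (mergeCoeff a b m q) (n ∸ 2)))
mainTheorem2 _ _ _ _ zero _ _ _ _ _ _ _ p≢0 _ = ⊥-elim (p≢0 refl)
mainTheorem2 _ _ _ _ (suc _) zero _ _ _ _ _ _ _ q≢0 = ⊥-elim (q≢0 refl)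
mainTheorem2 n@(suc (suc n′)) m@(suc (suc m′)) a b (suc p) (suc q) (s≤s (s≤s _)) (s≤s (s≤s _))
             aₙ≢0 bₘ≢0 a₀≡0 b₀≡0 _ _ =
  (λ A B α↠A β↠B → Condenses-respʳ
     (⊕-cong (⊗-congˡ (Condenses-unique (cnf-condenses n a₀≡0) α↠A))
             (⊗-congˡ (Condenses-unique (cnf-condenses m b₀≡0) β↠B))) sum↠) ,
  (λ n<m → Condenses-respʳ
     (⊕≅term-⊕-cnf (≤′-step (≤⇒≤′ (≤-pred n<m))) ≤′-refl pX qY (∷-+ₒ-∷ qbₘ≢0)) sum↠) ,
  (λ { refl → Condenses-respʳ (⊕≅term-⊕-cnf ≤′-refl ≤′-refl pX qY (∷-+ₒ-∷ qbₘ≢0)) sum↠ }) ,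
  (λ m<n → let m≤n′ = ≤⇒≤′ (≤-pred m<n) in Condenses-respʳ
     (⊕≅term-⊕-cnf ≤′-refl (≤′-step m≤n′) pX qY (cong (suc p * a n ∷_)
        (+ₒ-pad-coeffs m≤n′ qbₘ≢0 (λ _ → mergeCoeff-<) mergeCoeff-≡ (λ _ m< _ → mergeCoeff-> m<))))
     sum↠)
  where
  open MergeCoeff a b m (suc q)
  sum↠ : Condenses (suc p · cnf a n ⊕ suc q · cnf b m)
                   (suc p · Below (coeffs (a ∘ suc) n) ⊕ suc q · Below (coeffs (b ∘ suc) m))
  sum↠ = ·cnf-⊕-·cnf-condenses n m (suc p) (suc q) a₀≡0 b₀≡0
  pX : suc p · Below (coeffs (a ∘ suc) n) ≅ Below (suc p * a n ∷ coeffs (a ∘ suc) (suc n′))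
  pX = ·Below-coeffs p (suc n′) aₙ≢0
  qY : suc q · Below (coeffs (b ∘ suc) m) ≅ Below (suc q * b m ∷ coeffs (b ∘ suc) (suc m′))
  qY = ·Below-coeffs q (suc m′) bₘ≢0
  qbₘ≢0 : suc q * b m ≢ 0
  qbₘ≢0 = suc*≢0 q bₘ≢0
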